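{- Let $a,b$ be positive integers and let $h_j=h^{a,b}_j$ denote the number of tilings of the honeycomb strip $H_j$ by monomers of $a$ colors and dimers of $b$ colors, with $h_0=1$ and $h_j=0$ for $j<0$. Then for every integer $n\ge 1$, $$h_n-a^n=b\,h_{n-2}+2b\sum_{k=3}^{n}a^{k-2}h_{n-k}+b^2\sum_{k=3}^{n}a^{k-3}h_{n-k-1}.$$
   Context: The honeycomb strip $H_n$ consists of $n$ regular hexagons arranged in two rows, numbered $1,\dots,n$ from the bottom left so that odd-numbered hexagons form the bottom row and even-numbered ones the top row; hexagon $i$ shares an edge with hexagons $i\pm1$ and $i\pm2$ (when they exist), and with no others. A monomer is a single hexagon; a dimer is a pair of edge-adjacent hexagons, i.e. either $\{i,i+1\}$ (slanted) or $\{i,i+2\}$ (horizontal). A tiling of $H_n$ is a partition of its hexagons into monomers and dimers; in a colored tiling each monomer receives one of $a$ colors and each dimer one of $b$ colors. -}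

module Defs where

open import Data.Nat using (ℕ; zero; suc; _+_; _*_; _^_; _<_; _≟_)
open import Data.Nat.Properties using (_<?_)
open import Data.Integer using (ℤ; +_; -[1+_]) renaming (_+_ to _+ℤ_; 0ℤ to zeroℤ)
import Data.Integer as Z
open import Data.List using (List; []; _∷_; map; concatMap; filter; length; upTo; _++_; drop; foldr)
open import Data.Nat.ListAction using (sum; product)
open import Data.List.Relation.Unary.All using (All; all?)
open import Relation.Binary.PropositionalEquality using (_≡_)
open import Relation.Nullary using (Dec)

-- Hexagons of H_n are numbered 0,…,n-1 (paper: 1,…,n).
-- Hexagon i is edge-adjacent exactly to i±1 and i±2.

data Tile : Set where
  mono  : ℕ → Tile
  dimer : ℕ → ℕ → Tile

cells : Tile → List ℕ
cells (mono i)    = i ∷ []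
cells (dimer i j) = i ∷ j ∷ []

-- All possible tiles of H_n: monomers {i}, slanted dimers {i,i+1},
-- horizontal dimers {i,i+2}, all inside H_n.
tiles : ℕ → List Tile
tiles n = map mono (upTo n)
       ++ concatMap (λ i → slant i (suc i <? n) ++ horiz i (suc (suc i) <? n)) (upTo n)
  where
  slant : (i : ℕ) → Dec (suc i < n) → List Tile
  slant i (Relation.Nullary.yes _) = dimer i (suc i) ∷ []
  slant i (Relation.Nullary.no _)  = []
  horiz : (i : ℕ) → Dec (suc (suc i) < n) → List Tile
  horiz i (Relation.Nullary.yes _) = dimer i (suc (suc i)) ∷ []
  horiz i (Relation.Nullary.no _)  = []

sublists : {A : Set} → List A → List (List A)
sublists []       = [] ∷ []
sublists (x ∷ xs) = let r = sublists xs in r ++ map (x ∷_) r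

multiplicity : List Tile → ℕ → ℕ
multiplicity T j = length (filter (_≟ j) (concatMap cells T))

IsTiling : ℕ → List Tile → Set
IsTiling n T = All (λ j → multiplicity T j ≡ 1) (upTo n)

isTiling? : (n : ℕ) → (T : List Tile) → Dec (IsTiling n T)
isTiling? n T = all? (λ j → multiplicity T j ≟ 1) (upTo n)

colorings : ℕ → ℕ → List Tile → ℕ
colorings a b T = product (map w T)
  where
  w : Tile → ℕ
  w (mono _)    = a
  w (dimer _ _) = b

hN : ℕ → ℕ → ℕ → ℕ
hN a b n = sum (map (colorings a b) (filter (isTiling? n) (sublists (tiles n))))

h : ℕ → ℕ → ℤ → ℕ
h a b (+ n)      = hN a b n
h a b -[1+ _ ]   = 0

Σ[_≤k≤_] : ℕ → ℕ → (ℕ → ℤ) → ℤ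
Σ[ lo ≤k≤ hi ] f = foldr (λ k s → f k +ℤ s) (+ 0) (drop lo (upTo (suc hi)))

module Submission where

-- Condition on the tile covering hexagon 0 (hexagons are numbered from 0).  A monomer leaves
-- H_{n-1}, the slanted dimer {0,1} leaves H_{n-2}, and the horizontal dimer {0,2} leaves H_{n-1}
-- without its hexagon 1; tilings of the latter region are counted the same way (a monomer or the
-- horizontal dimer at its hexagon 0), giving a h_{n-3} + b h_{n-4}.  Hence, with h_j = 0 for j < 0,
--   h_{m+1} = a h_m + b h_{m-1} + a b h_{m-2} + b² h_{m-3},
-- and the closed form follows by induction on n, since the two sums of the statement telescope:
-- S₁(m+1) = a h_{m-2} + a S₁(m) and S₂(m+1) = h_{m-3} + a S₂(m).
--
-- To make the conditioning precise, colored tilings are counted more generally against a profile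
-- v : ℕ → ℕ, asking for hexagon j to be covered exactly v j times.  This count obeys a recursion
-- over the list of candidate tiles which is invariant under permuting that list, so the tiles of
-- H_{m+1} may be listed as: the monomer at 0, the dimers at 0, then the tiles of H_m shifted by one.

open import Defs
open import Data.Bool.Base using (Bool; true; false; _∧_)
open import Data.Integer.Base using (ℤ; +_; -[1+_])
import Data.Integer.Base as ℤ
open import Data.List.Base
  using (List; []; _∷_; [_]; _++_; map; concatMap; filter; length; upTo; applyUpTo; drop; foldr)
open import Data.List.Properties
  using (map-++; map-∘; map-cong; map-upTo; filter-++; length-++; concatMap-cong; concatMap-map;
         map-concatMap; foldr-map; drop-map)
open import Data.List.Relation.Binary.Permutation.Propositional as ↭
  using (_↭_; prep; swap; ↭-reflexive; ↭-trans)
open import Data.List.Relation.Binary.Permutation.Propositional.Properties using (shifts)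
open import Data.List.Relation.Unary.All using (All; []; _∷_; all?)
open import Data.Nat.Base using (ℕ; zero; suc)
import Data.Nat.Base as ℕ
open import Data.Product.Base using (Σ-syntax; proj₁; proj₂; _,_)
open import Function.Base using (_∘_)
open import Relation.Binary.PropositionalEquality using (_≡_; refl; sym; trans; cong; cong₂; module ≡-Reasoning)
open import Relation.Nullary.Decidable.Core using (Dec; yes; no; does)

module Indicators where
  open import Algebra.Bundles using (CommutativeMonoid)
  open import Data.Bool.Properties using (∧-commutativeMonoid)
  open import Data.Nat.Base using (_+_; _*_; _∸_; _≡ᵇ_; _≤ᵇ_; _<ᵇ_)
  open import Data.Nat.Properties using (+-identityʳ; *-zeroʳ; *-distribˡ-+)
  open import Data.Nat.ListAction using (sum)
  open import Algebra.Properties.CommutativeSemigroup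
    (CommutativeMonoid.commutativeSemigroup ∧-commutativeMonoid) using (interchange)

  𝟙 : Bool → ℕ
  𝟙 true  = 1
  𝟙 false = 0

  𝟙-∧ : ∀ p q → 𝟙 (p ∧ q) ≡ 𝟙 p * 𝟙 q
  𝟙-∧ true  q = sym (+-identityʳ (𝟙 q))
  𝟙-∧ false q = refl

  allBelow : ℕ → (ℕ → Bool) → Bool
  allBelow zero    p = true
  allBelow (suc n) p = p 0 ∧ allBelow n (p ∘ suc)

  allBelow-cong : ∀ n {p q : ℕ → Bool} → (∀ j → p j ≡ q j) → allBelow n p ≡ allBelow n q
  allBelow-cong zero    p≗q = refl
  allBelow-cong (suc n) p≗q = cong₂ _∧_ (p≗q 0) (allBelow-cong n (p≗q ∘ suc))

  allBelow-∧ : ∀ n (p q : ℕ → Bool) → allBelow n (λ j → p j ∧ q j) ≡ allBelow n p ∧ allBelow n q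
  allBelow-∧ zero    p q = refl
  allBelow-∧ (suc n) p q =
    trans (cong ((p 0 ∧ q 0) ∧_) (allBelow-∧ n (p ∘ suc) (q ∘ suc))) (interchange (p 0) (q 0) _ _)

  allBelow-true : ∀ n → allBelow n (λ _ → true) ≡ true
  allBelow-true zero    = refl
  allBelow-true (suc n) = allBelow-true n

  does-all?-applyUpTo : ∀ {P : ℕ → Set} (P? : ∀ j → Dec (P j)) f n →
    does (all? P? (applyUpTo f n)) ≡ allBelow n (λ j → does (P? (f j)))
  does-all?-applyUpTo P? f zero    = refl
  does-all?-applyUpTo P? f (suc n) = cong (does (P? (f 0)) ∧_) (does-all?-applyUpTo P? (f ∘ suc) n)

  <ᵇ-suc : ∀ m n → (m <ᵇ suc n) ≡ (m ≤ᵇ n)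
  <ᵇ-suc zero    n = refl
  <ᵇ-suc (suc m) n = refl

  ≡ᵇ-+ : ∀ d u v → (d + u ≡ᵇ v) ≡ (d ≤ᵇ v) ∧ (u ≡ᵇ v ∸ d)
  ≡ᵇ-+ zero    u v       = refl
  ≡ᵇ-+ (suc d) u zero    = refl
  ≡ᵇ-+ (suc d) u (suc v) = trans (≡ᵇ-+ d u v) (cong (_∧ (u ≡ᵇ v ∸ d)) (sym (<ᵇ-suc d v)))

  ≤ᵇ-+ : ∀ d e v → (d ≤ᵇ v) ∧ (e ≤ᵇ v ∸ d) ≡ (d + e ≤ᵇ v)
  ≤ᵇ-+ zero    e v       = refl
  ≤ᵇ-+ (suc d) e zero    = refl
  ≤ᵇ-+ (suc d) e (suc v) =
    trans (cong (_∧ (e ≤ᵇ v ∸ d)) (<ᵇ-suc d v)) (trans (≤ᵇ-+ d e v) (sym (<ᵇ-suc (d + e) v)))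

  sum-filter : ∀ {A : Set} {P : A → Set} (P? : ∀ x → Dec (P x)) (g : A → ℕ) xs →
    sum (map g (filter P? xs)) ≡ sum (map (λ x → 𝟙 (does (P? x)) * g x) xs)
  sum-filter P? g []       = refl
  sum-filter P? g (x ∷ xs) with does (P? x)
  ... | true  = cong₂ _+_ (sym (+-identityʳ (g x))) (sum-filter P? g xs)
  ... | false = sum-filter P? g xs

  sum-map-*ˡ : ∀ {A : Set} c (g : A → ℕ) xs → sum (map (λ x → c * g x) xs) ≡ c * sum (map g xs)
  sum-map-*ˡ c g []       = sym (*-zeroʳ c)
  sum-map-*ˡ c g (x ∷ xs) = trans (cong (_+_ (c * g x)) (sum-map-*ˡ c g xs)) (sym (*-distribˡ-+ c (g x) _))

module Covers where
  open Indicators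
  open import Data.Nat.Base using (_+_; _∸_; _≡ᵇ_; _≤ᵇ_)
  open import Data.Nat.Properties using (_≟_; _<?_; +-comm; ∸-+-assoc)

  cover : Tile → ℕ → ℕ
  cover x j = length (filter (_≟ j) (cells x))

  multiplicity-∷ : ∀ x S j → multiplicity (x ∷ S) j ≡ cover x j + multiplicity S j
  multiplicity-∷ x S j =
    trans (cong length (filter-++ (_≟ j) (cells x) (concatMap cells S))) (length-++ (filter (_≟ j) (cells x)))

  _∖_ : (ℕ → ℕ) → Tile → ℕ → ℕ
  (v ∖ x) j = v j ∸ cover x j

  ∖-comm : ∀ v x y j → ((v ∖ x) ∖ y) j ≡ ((v ∖ y) ∖ x) j
  ∖-comm v x y j = trans (∸-+-assoc (v j) (cover x j) (cover y j))
    (trans (cong (v j ∸_) (+-comm (cover x j) (cover y j))) (sym (∸-+-assoc (v j) (cover y j) (cover x j))))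

  fits : ℕ → Tile → (ℕ → ℕ) → Bool
  fits n x v = allBelow n (λ j → cover x j ≤ᵇ v j)

  exact : ℕ → (ℕ → ℕ) → List Tile → Bool
  exact n v S = allBelow n (λ j → multiplicity S j ≡ᵇ v j)

  exact-∷ : ∀ n v x S → exact n v (x ∷ S) ≡ fits n x v ∧ exact n (v ∖ x) S
  exact-∷ n v x S = trans
    (allBelow-cong n (λ j → trans (cong (_≡ᵇ v j) (multiplicity-∷ x S j))
                                  (≡ᵇ-+ (cover x j) (multiplicity S j) (v j))))
    (allBelow-∧ n _ _)

  fits-∖-comm : ∀ n x y v → fits n x v ∧ fits n y (v ∖ x) ≡ fits n y v ∧ fits n x (v ∖ y)
  fits-∖-comm n x y v = trans (sym (allBelow-∧ n _ _)) (trans (allBelow-cong n swapped) (allBelow-∧ n _ _))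
    where
    swapped : ∀ j → (cover x j ≤ᵇ v j) ∧ (cover y j ≤ᵇ v j ∸ cover x j)
                  ≡ (cover y j ≤ᵇ v j) ∧ (cover x j ≤ᵇ v j ∸ cover y j)
    swapped j = trans (≤ᵇ-+ (cover x j) (cover y j) (v j))
      (trans (cong (_≤ᵇ v j) (+-comm (cover x j) (cover y j))) (sym (≤ᵇ-+ (cover y j) (cover x j) (v j))))

  shift : Tile → Tile
  shift (mono i)    = mono (suc i)
  shift (dimer i j) = dimer (suc i) (suc j)

  cover-shift-zero : ∀ x → cover (shift x) 0 ≡ 0
  cover-shift-zero (mono i)    = refl
  cover-shift-zero (dimer i j) = refl

  cover-shift-suc : ∀ x j → cover (shift x) (suc j) ≡ cover x j
  cover-shift-suc (mono i) j with i ≡ᵇ j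
  ... | true  = refl
  ... | false = refl
  cover-shift-suc (dimer i k) j with i ≡ᵇ j
  ... | true with k ≡ᵇ j
  ...   | true  = refl
  ...   | false = refl
  cover-shift-suc (dimer i k) j | false with k ≡ᵇ j
  ...   | true  = refl
  ...   | false = refl

  fits-shift : ∀ m x v → fits (suc m) (shift x) v ≡ fits m x (v ∘ suc)
  fits-shift m x v = cong₂ _∧_ (cong (_≤ᵇ v 0) (cover-shift-zero x))
    (allBelow-cong m (λ j → cong (_≤ᵇ v (suc j)) (cover-shift-suc x j)))

  when : {P A : Set} → Dec P → A → List A
  when (yes _) x = [ x ]
  when (no _)  x = []

  map-when : ∀ {P Q A B : Set} (p? : Dec P) (q? : Dec Q) → does p? ≡ does q? →
    ∀ (f : A → B) x → when p? (f x) ≡ map f (when q? x)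
  map-when (yes _) (yes _) _  f x = refl
  map-when (no _)  (no _)  _  f x = refl
  map-when (yes _) (no _)  () f x
  map-when (no _)  (yes _) () f x

  dimersAt : ℕ → ℕ → List Tile
  dimersAt n i = when (suc i <? n) (dimer i (suc i)) ++ when (suc (suc i) <? n) (dimer i (suc (suc i)))

  -- `tiles` builds its dimers with where-bound helpers, which cannot be named here:
  -- unification recovers the block function, and `with` on the two decisions evaluates it.
  private
    tiles-blocks : ∀ n → Σ[ F ∈ (ℕ → List Tile) ] tiles n ≡ map mono (upTo n) ++ concatMap F (upTo n)
    tiles-blocks n = _ , refl

    blocks-dimersAt : ∀ n i → proj₁ (tiles-blocks n) i ≡ dimersAt n i
    blocks-dimersAt n i with suc i <? n | suc (suc i) <? n
    ... | yes _ | yes _ = refl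
    ... | yes _ | no _  = refl
    ... | no _  | yes _ = refl
    ... | no _  | no _  = refl

  tiles-≡ : ∀ n → tiles n ≡ map mono (upTo n) ++ concatMap (dimersAt n) (upTo n)
  tiles-≡ n = trans (proj₂ (tiles-blocks n))
    (cong (map mono (upTo n) ++_) (concatMap-cong (blocks-dimersAt n) (upTo n)))

  -- Each `refl` holds because both decisions compute their answer by the same test `_<ᵇ_`.
  dimersAt-suc : ∀ n i → dimersAt (suc n) (suc i) ≡ map shift (dimersAt n i)
  dimersAt-suc n i = trans
    (cong₂ _++_ (map-when (suc (suc i) <? suc n) (suc i <? n) refl shift (dimer i (suc i)))
                (map-when (suc (suc (suc i)) <? suc n) (suc (suc i) <? n) refl shift (dimer i (suc (suc i)))))
    (sym (map-++ shift (when (suc i <? n) _) _))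

  dimersAt-zero-cover : ∀ m → All (λ x → cover x 0 ≡ 1) (dimersAt (suc m) 0)
  dimersAt-zero-cover zero          = []
  dimersAt-zero-cover (suc zero)    = refl ∷ []
  dimersAt-zero-cover (suc (suc m)) = refl ∷ refl ∷ []

  tiles-suc : ∀ m → tiles (suc m) ↭ mono 0 ∷ dimersAt (suc m) 0 ++ map shift (tiles m)
  tiles-suc m = ↭-trans (↭-reflexive split-zero)
    (prep (mono 0) (↭-trans (shifts (map shift monos) (dimersAt (suc m) 0))
                            (↭-reflexive (cong (dimersAt (suc m) 0 ++_) shifted-tiles))))
    where
    U : List ℕ
    U = upTo m
    monos dimers : List Tile
    monos = map mono U
    dimers = concatMap (dimersAt m) U

    split-zero : tiles (suc m) ≡ mono 0 ∷ map shift monos ++ dimersAt (suc m) 0 ++ map shift dimers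
    split-zero = trans (tiles-≡ (suc m)) (cong₂ (λ xs ys → mono 0 ∷ xs ++ dimersAt (suc m) 0 ++ ys)
      (trans (cong (map mono) (sym (map-upTo suc m))) (trans (sym (map-∘ U)) (map-∘ U)))
      (trans (cong (concatMap (dimersAt (suc m))) (sym (map-upTo suc m)))
        (trans (concatMap-map (dimersAt (suc m)) suc U)
          (trans (concatMap-cong (dimersAt-suc m) U) (sym (map-concatMap shift (dimersAt m) U))))))

    shifted-tiles : map shift monos ++ map shift dimers ≡ map shift (tiles m)
    shifted-tiles = trans (sym (map-++ shift monos dimers)) (cong (map shift) (sym (tiles-≡ m)))

Recurrence : ℕ → ℕ → (ℤ → ℕ) → Set
Recurrence a b f = ∀ m →
  f (+ suc m) ≡ a ℕ.* f (+ m) ℕ.+ b ℕ.* f (+ m ℤ.- + 1)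
                ℕ.+ a ℕ.* b ℕ.* f (+ m ℤ.- + 2) ℕ.+ b ℕ.* b ℕ.* f (+ m ℤ.- + 3)

Recurrence-cong : ∀ {a b f g} → (∀ i → f i ≡ g i) → Recurrence a b f → Recurrence a b g
Recurrence-cong {a} {b} f≗g rec m = trans (sym (f≗g _)) (trans (rec m)
  (cong₂ ℕ._+_ (cong₂ ℕ._+_ (cong₂ ℕ._+_ (cong (a ℕ.*_) (f≗g _)) (cong (b ℕ.*_) (f≗g _)))
                           (cong (a ℕ.* b ℕ.*_) (f≗g _)))
               (cong (b ℕ.* b ℕ.*_) (f≗g _))))

module Tilings (a b : ℕ) where
  open Indicators
  open Covers
  open import Data.Nat.Base using (_+_; _*_; _∸_; _≡ᵇ_; _≤ᵇ_)
  open import Data.Nat.Properties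
    using (_≟_; +-identityʳ; *-identityʳ; *-zeroʳ; +-comm; *-comm; *-distribˡ-+;
           +-commutativeSemigroup; *-commutativeSemigroup)
  open import Algebra.Properties.CommutativeSemigroup +-commutativeSemigroup
    using () renaming (interchange to +-interchange)
  open import Algebra.Properties.CommutativeSemigroup *-commutativeSemigroup
    using () renaming (interchange to *-interchange)
  open import Data.Nat.ListAction using (sum)
  open import Data.Nat.ListAction.Properties using (sum-++)
  open import Data.Nat.Tactic.RingSolver using (solve-∀)
  open ≡-Reasoning

  weight : Tile → ℕ
  weight (mono _)    = a
  weight (dimer _ _) = b

  weight-shift : ∀ x → weight (shift x) ≡ weight x
  weight-shift (mono _)    = refl
  weight-shift (dimer _ _) = refl

  colorings-∷ : ∀ x S → colorings a b (x ∷ S) ≡ weight x * colorings a b S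
  colorings-∷ (mono _)    S = refl
  colorings-∷ (dimer _ _) S = refl

  coverCount : ℕ → List Tile → (ℕ → ℕ) → ℕ
  coverCount n []      v = 𝟙 (exact n v [])
  coverCount n (x ∷ L) v = coverCount n L v + 𝟙 (fits n x v) * weight x * coverCount n L (v ∖ x)

  selectionWeight : ℕ → (ℕ → ℕ) → List Tile → ℕ
  selectionWeight n v S = 𝟙 (exact n v S) * colorings a b S

  selectionWeight-∷ : ∀ n v x S →
    selectionWeight n v (x ∷ S) ≡ 𝟙 (fits n x v) * weight x * selectionWeight n (v ∖ x) S
  selectionWeight-∷ n v x S = begin
    𝟙 (exact n v (x ∷ S)) * colorings a b (x ∷ S)
      ≡⟨ cong₂ _*_ (trans (cong 𝟙 (exact-∷ n v x S)) (𝟙-∧ (fits n x v) _)) (colorings-∷ x S) ⟩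
    𝟙 (fits n x v) * 𝟙 (exact n (v ∖ x) S) * (weight x * colorings a b S)
      ≡⟨ *-interchange (𝟙 (fits n x v)) (𝟙 (exact n (v ∖ x) S)) (weight x) (colorings a b S) ⟩
    𝟙 (fits n x v) * weight x * (𝟙 (exact n (v ∖ x) S) * colorings a b S) ∎

  sum-sublists : ∀ n L v → sum (map (selectionWeight n v) (sublists L)) ≡ coverCount n L v
  sum-sublists n []      v = trans (+-identityʳ _) (*-identityʳ _)
  sum-sublists n (x ∷ L) v = begin
    sum (map W (Ss ++ map (x ∷_) Ss))
      ≡⟨ cong sum (map-++ W Ss (map (x ∷_) Ss)) ⟩
    sum (map W Ss ++ map W (map (x ∷_) Ss))
      ≡⟨ sum-++ (map W Ss) _ ⟩
    sum (map W Ss) + sum (map W (map (x ∷_) Ss))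
      ≡⟨ cong₂ _+_ (sum-sublists n L v)
                   (cong sum (trans (sym (map-∘ Ss)) (map-cong (selectionWeight-∷ n v x) Ss))) ⟩
    coverCount n L v + sum (map (λ S → c * selectionWeight n (v ∖ x) S) Ss)
      ≡⟨ cong (_+_ (coverCount n L v)) (sum-map-*ˡ c (selectionWeight n (v ∖ x)) Ss) ⟩
    coverCount n L v + c * sum (map (selectionWeight n (v ∖ x)) Ss)
      ≡⟨ cong (λ s → coverCount n L v + c * s) (sum-sublists n L (v ∖ x)) ⟩
    coverCount n L v + c * coverCount n L (v ∖ x) ∎
    where
    W : List Tile → ℕ
    W = selectionWeight n v
    Ss : List (List Tile)
    Ss = sublists L
    c : ℕ
    c = 𝟙 (fits n x v) * weight x

  tilings : ℕ → (ℕ → ℕ) → ℕ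
  tilings n = coverCount n (tiles n)

  full : ℕ → ℕ
  full _ = 1

  hN-tilings : ∀ n → hN a b n ≡ tilings n full
  hN-tilings n = begin
    sum (map (colorings a b) (filter (isTiling? n) (sublists (tiles n))))
      ≡⟨ sum-filter (isTiling? n) (colorings a b) (sublists (tiles n)) ⟩
    sum (map (λ S → 𝟙 (does (isTiling? n S)) * colorings a b S) (sublists (tiles n)))
      ≡⟨ cong sum (map-cong (λ S → cong (λ t → 𝟙 t * colorings a b S)
                                          (does-all?-applyUpTo (λ j → multiplicity S j ≟ 1) (λ j → j) n))
                            (sublists (tiles n))) ⟩
    sum (map (selectionWeight n full) (sublists (tiles n)))
      ≡⟨ sum-sublists n (tiles n) full ⟩
    tilings n full ∎

  coverCount-cong : ∀ n L {v w} → (∀ j → v j ≡ w j) → coverCount n L v ≡ coverCount n L w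
  coverCount-cong n []      v≗w = cong 𝟙 (allBelow-cong n (λ j → cong (0 ≡ᵇ_) (v≗w j)))
  coverCount-cong n (x ∷ L) v≗w = cong₂ _+_ (coverCount-cong n L v≗w)
    (cong₂ (λ f r → 𝟙 f * weight x * r) (allBelow-cong n (λ j → cong (cover x j ≤ᵇ_) (v≗w j)))
                                       (coverCount-cong n L (λ j → cong (_∸ cover x j) (v≗w j))))

  coverCount-∷-cong : ∀ n x L L′ → (∀ v → coverCount n L v ≡ coverCount n L′ v) →
    ∀ v → coverCount n (x ∷ L) v ≡ coverCount n (x ∷ L′) v
  coverCount-∷-cong n x L L′ L≈L′ v =
    cong₂ (λ r s → r + 𝟙 (fits n x v) * weight x * s) (L≈L′ v) (L≈L′ (v ∖ x))

  coverCount-swap : ∀ n x y L v → coverCount n (x ∷ y ∷ L) v ≡ coverCount n (y ∷ x ∷ L) v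
  coverCount-swap n x y L v = begin
    (C + Y * wy * Cy) + X * wx * (Cx + Y′ * wy * Cxy)
      ≡⟨ cong (_+_ (C + Y * wy * Cy)) (*-distribˡ-+ (X * wx) Cx _) ⟩
    (C + Y * wy * Cy) + (X * wx * Cx + X * wx * (Y′ * wy * Cxy))
      ≡⟨ +-interchange C _ _ _ ⟩
    (C + X * wx * Cx) + (Y * wy * Cy + X * wx * (Y′ * wy * Cxy))
      ≡⟨ cong (λ t → (C + X * wx * Cx) + (Y * wy * Cy + t)) both-placed ⟩
    (C + X * wx * Cx) + (Y * wy * Cy + Y * wy * (X′ * wx * Cyx))
      ≡⟨ cong (_+_ (C + X * wx * Cx)) (*-distribˡ-+ (Y * wy) Cy _) ⟨
    (C + X * wx * Cx) + Y * wy * (Cy + X′ * wx * Cyx) ∎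
    where
    C Cx Cy Cxy Cyx X Y X′ Y′ wx wy : ℕ
    C = coverCount n L v
    Cx = coverCount n L (v ∖ x)
    Cy = coverCount n L (v ∖ y)
    Cxy = coverCount n L ((v ∖ x) ∖ y)
    Cyx = coverCount n L ((v ∖ y) ∖ x)
    X = 𝟙 (fits n x v)
    Y = 𝟙 (fits n y v)
    X′ = 𝟙 (fits n x (v ∖ y))
    Y′ = 𝟙 (fits n y (v ∖ x))
    wx = weight x
    wy = weight y

    regroup : ∀ p q r s t → p * q * (r * s * t) ≡ p * r * (q * s * t)
    regroup = solve-∀

    both-placed : X * wx * (Y′ * wy * Cxy) ≡ Y * wy * (X′ * wx * Cyx)
    both-placed = begin
      X * wx * (Y′ * wy * Cxy) ≡⟨ regroup X wx Y′ wy Cxy ⟩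
      X * Y′ * (wx * wy * Cxy)
        ≡⟨ cong₂ _*_ both-fit (cong₂ _*_ (*-comm wx wy) (coverCount-cong n L (∖-comm v x y))) ⟩
      Y * X′ * (wy * wx * Cyx) ≡⟨ regroup Y wy X′ wx Cyx ⟨
      Y * wy * (X′ * wx * Cyx) ∎
      where
      both-fit : X * Y′ ≡ Y * X′
      both-fit = trans (sym (𝟙-∧ (fits n x v) _)) (trans (cong 𝟙 (fits-∖-comm n x y v)) (𝟙-∧ (fits n y v) _))

  coverCount-↭ : ∀ n {L L′} → L ↭ L′ → ∀ v → coverCount n L v ≡ coverCount n L′ v
  coverCount-↭ n ↭.refl                     v = refl
  coverCount-↭ n (prep {L} {L′} x p)        v = coverCount-∷-cong n x L L′ (coverCount-↭ n p) v
  coverCount-↭ n (swap {L} {L′} x y p)      v = trans (coverCount-swap n x y L v)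
    (coverCount-∷-cong n y (x ∷ L) (x ∷ L′) (coverCount-∷-cong n x L L′ (coverCount-↭ n p)) v)
  coverCount-↭ n (↭.trans p q)              v = trans (coverCount-↭ n p v) (coverCount-↭ n q v)

  coverCount-shift : ∀ m L v → v 0 ≡ 0 → coverCount (suc m) (map shift L) v ≡ coverCount m L (v ∘ suc)
  coverCount-shift m []      v v₀≡0 rewrite v₀≡0 = refl
  coverCount-shift m (x ∷ L) v v₀≡0 = cong₂ _+_ (coverCount-shift m L v v₀≡0)
    (cong₂ _*_ (cong₂ _*_ (cong 𝟙 (fits-shift m x v)) (weight-shift x))
      (trans (coverCount-shift m L (v ∖ shift x) (trans (cong (v 0 ∸_) (cover-shift-zero x)) v₀≡0))
             (coverCount-cong m L (λ j → cong (v (suc j) ∸_) (cover-shift-suc x j)))))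

  coverCount-shift-blocked : ∀ m L v {k} → v 0 ≡ suc k → coverCount (suc m) (map shift L) v ≡ 0
  coverCount-shift-blocked m []      v v₀≡1+k rewrite v₀≡1+k = refl
  coverCount-shift-blocked m (x ∷ L) v v₀≡1+k
    rewrite coverCount-shift-blocked m L v v₀≡1+k
          | coverCount-shift-blocked m L (v ∖ shift x) (trans (cong (v 0 ∸_) (cover-shift-zero x)) v₀≡1+k)
    = *-zeroʳ (𝟙 (fits (suc m) (shift x) v) * weight (shift x))

  coverCount-vacant : ∀ m D L v → All (λ x → cover x 0 ≡ 1) D → v 0 ≡ 0 →
    coverCount (suc m) (D ++ L) v ≡ coverCount (suc m) L v
  coverCount-vacant m []      L v []             v₀≡0 = refl
  coverCount-vacant m (x ∷ D) L v (x₀≡1 ∷ D₀≡1) v₀≡0 rewrite x₀≡1 | v₀≡0 =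
    trans (+-identityʳ _) (coverCount-vacant m D L v D₀≡1 v₀≡0)

  coverCount-occupied : ∀ m D L v → All (λ x → cover x 0 ≡ 1) D → v 0 ≡ 1 →
    coverCount (suc m) (D ++ map shift L) v
      ≡ sum (map (λ x → 𝟙 (fits (suc m) x v) * weight x * coverCount m L ((v ∖ x) ∘ suc)) D)
  coverCount-occupied m []      L v []             v₀≡1 = coverCount-shift-blocked m L v v₀≡1
  coverCount-occupied m (x ∷ D) L v (x₀≡1 ∷ D₀≡1) v₀≡1 = begin
    coverCount (suc m) (D ++ map shift L) v + c * coverCount (suc m) (D ++ map shift L) (v ∖ x)
      ≡⟨ cong₂ (λ r s → r + c * s) (coverCount-occupied m D L v D₀≡1 v₀≡1)
               (trans (coverCount-vacant m D _ (v ∖ x) D₀≡1 vx₀≡0) (coverCount-shift m L (v ∖ x) vx₀≡0)) ⟩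
    sum (map g D) + c * coverCount m L ((v ∖ x) ∘ suc)
      ≡⟨ +-comm (sum (map g D)) _ ⟩
    c * coverCount m L ((v ∖ x) ∘ suc) + sum (map g D) ∎
    where
    c : ℕ
    c = 𝟙 (fits (suc m) x v) * weight x
    g : Tile → ℕ
    g y = 𝟙 (fits (suc m) y v) * weight y * coverCount m L ((v ∖ y) ∘ suc)
    vx₀≡0 : (v ∖ x) 0 ≡ 0
    vx₀≡0 = cong₂ _∸_ v₀≡1 x₀≡1

  tilings-suc-vacant : ∀ m v → v 0 ≡ 0 → tilings (suc m) v ≡ tilings m (v ∘ suc)
  tilings-suc-vacant m v v₀≡0 = begin
    tilings (suc m) v
      ≡⟨ coverCount-↭ (suc m) (tiles-suc m) v ⟩
    coverCount (suc m) ((mono 0 ∷ dimersAt (suc m) 0) ++ map shift (tiles m)) v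
      ≡⟨ coverCount-vacant m (mono 0 ∷ dimersAt (suc m) 0) _ v (refl ∷ dimersAt-zero-cover m) v₀≡0 ⟩
    coverCount (suc m) (map shift (tiles m)) v
      ≡⟨ coverCount-shift m (tiles m) v v₀≡0 ⟩
    tilings m (v ∘ suc) ∎

  tilings-suc-occupied : ∀ m v → v 0 ≡ 1 → tilings (suc m) v
    ≡ sum (map (λ x → 𝟙 (fits (suc m) x v) * weight x * tilings m ((v ∖ x) ∘ suc)) (mono 0 ∷ dimersAt (suc m) 0))
  tilings-suc-occupied m v v₀≡1 = trans (coverCount-↭ (suc m) (tiles-suc m) v)
    (coverCount-occupied m (mono 0 ∷ dimersAt (suc m) 0) (tiles m) v (refl ∷ dimersAt-zero-cover m) v₀≡1)

  -- G n counts the tilings of H_n with its hexagon 1 removed.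
  H G : ℕ → ℕ
  H n = tilings n full
  G n = tilings n ((full ∖ dimer 0 2) ∘ suc)

  private
    unit-weights₁ : ∀ p x → 1 * p * x + 0 ≡ p * x
    unit-weights₁ = solve-∀

    unit-weights₂ : ∀ p q x y → 1 * p * x + (1 * q * y + 0) ≡ p * x + q * y
    unit-weights₂ = solve-∀

    unit-weights₃ : ∀ p q x y z → 1 * p * x + (1 * q * y + (1 * q * z + 0)) ≡ p * x + q * y + q * z
    unit-weights₃ = solve-∀

  H-1 : H 1 ≡ a * H 0
  H-1 = trans (tilings-suc-occupied 0 full refl) (unit-weights₁ a (H 0))

  H-2 : H 2 ≡ a * H 1 + b * H 0
  H-2 = trans (tilings-suc-occupied 1 full refl) (unit-weights₂ a b (H 1) (H 0))

  H-3+ : ∀ k → H (3 + k) ≡ a * H (2 + k) + b * H (1 + k) + b * G (2 + k)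
  H-3+ k = begin
    H (3 + k)
      ≡⟨ tilings-suc-occupied (2 + k) full refl ⟩
    𝟙 t * a * H (2 + k) + (𝟙 t * b * tilings (2 + k) ((full ∖ dimer 0 1) ∘ suc) + (𝟙 t * b * G (2 + k) + 0))
      ≡⟨ cong₂ (λ u r → 𝟙 u * a * H (2 + k) + (𝟙 u * b * r + (𝟙 u * b * G (2 + k) + 0)))
               (allBelow-true k) (tilings-suc-vacant (1 + k) _ refl) ⟩
    1 * a * H (2 + k) + (1 * b * H (1 + k) + (1 * b * G (2 + k) + 0))
      ≡⟨ unit-weights₃ a b (H (2 + k)) (H (1 + k)) (G (2 + k)) ⟩
    a * H (2 + k) + b * H (1 + k) + b * G (2 + k) ∎
    where
    t : Bool
    t = allBelow k (λ _ → true)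

  G-2 : G 2 ≡ a * H 0
  G-2 = trans (tilings-suc-occupied 1 ((full ∖ dimer 0 2) ∘ suc) refl) (unit-weights₁ a (H 0))

  G-3+ : ∀ k → G (3 + k) ≡ a * H (1 + k) + b * H k
  G-3+ k = begin
    G (3 + k)
      ≡⟨ tilings-suc-occupied (2 + k) w refl ⟩
    𝟙 t * a * tilings (2 + k) (w ∘ suc) + (𝟙 t * b * tilings (2 + k) ((w ∖ dimer 0 2) ∘ suc) + 0)
      ≡⟨ cong (λ u → 𝟙 u * a * tilings (2 + k) (w ∘ suc)
                      + (𝟙 u * b * tilings (2 + k) ((w ∖ dimer 0 2) ∘ suc) + 0))
              (allBelow-true k) ⟩
    1 * a * tilings (2 + k) (w ∘ suc) + (1 * b * tilings (2 + k) ((w ∖ dimer 0 2) ∘ suc) + 0)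
      ≡⟨ cong₂ (λ r s → 1 * a * r + (1 * b * s + 0)) (tilings-suc-vacant (1 + k) (w ∘ suc) refl)
               (trans (tilings-suc-vacant (1 + k) _ refl) (tilings-suc-vacant k _ refl)) ⟩
    1 * a * H (1 + k) + (1 * b * H k + 0)
      ≡⟨ unit-weights₂ a b (H (1 + k)) (H k) ⟩
    a * H (1 + k) + b * H k ∎
    where
    w : ℕ → ℕ
    w = (full ∖ dimer 0 2) ∘ suc
    t : Bool
    t = allBelow k (λ _ → true)

  Hℤ : ℤ → ℕ
  Hℤ (+ n)    = H n
  Hℤ -[1+ _ ] = 0

  Hℤ-recurrence : Recurrence a b Hℤ
  Hℤ-recurrence 0 = trans H-1 (pad₁ a b (H 0))
    where
    pad₁ : ∀ p q x → p * x ≡ p * x + q * 0 + p * q * 0 + q * q * 0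
    pad₁ = solve-∀
  Hℤ-recurrence 1 = trans H-2 (pad₂ a b (H 1) (H 0))
    where
    pad₂ : ∀ p q x y → p * x + q * y ≡ p * x + q * y + p * q * 0 + q * q * 0
    pad₂ = solve-∀
  Hℤ-recurrence 2 = trans (H-3+ 0) (trans (cong (λ g → a * H 2 + b * H 1 + b * g) G-2) (pad₃ a b (H 2) (H 1) (H 0)))
    where
    pad₃ : ∀ p q x y z → p * x + q * y + q * (p * z) ≡ p * x + q * y + p * q * z + q * q * 0
    pad₃ = solve-∀
  Hℤ-recurrence (suc (suc (suc k))) =
    trans (H-3+ (1 + k)) (trans (cong (λ g → a * H (3 + k) + b * H (2 + k) + b * g) (G-3+ k))
                                (expand a b (H (3 + k)) (H (2 + k)) (H (1 + k)) (H k)))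
    where
    expand : ∀ p q x y z u → p * x + q * y + q * (p * z + q * u) ≡ p * x + q * y + p * q * z + q * q * u
    expand = solve-∀

  h≗Hℤ : ∀ i → h a b i ≡ Hℤ i
  h≗Hℤ (+ n)    = hN-tilings n
  h≗Hℤ -[1+ _ ] = refl

  h-recurrence : Recurrence a b (h a b)
  h-recurrence = Recurrence-cong {a} {b} (λ i → sym (h≗Hℤ i)) Hℤ-recurrence

module IntervalSums where
  open import Data.Integer.Base using (_+_; _*_)
  open import Data.Integer.Properties using (*-zeroʳ; *-distribˡ-+)
  open import Data.Nat.Base using (_≤_; z≤n; s≤s)
  open ≡-Reasoning

  sumOver : (ℕ → ℤ) → List ℕ → ℤ
  sumOver f = foldr (λ k s → f k + s) (+ 0)

  sumOver-cong : ∀ {f g} → (∀ k → f k ≡ g k) → ∀ ks → sumOver f ks ≡ sumOver g ks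
  sumOver-cong f≗g []       = refl
  sumOver-cong f≗g (k ∷ ks) = cong₂ _+_ (f≗g k) (sumOver-cong f≗g ks)

  sumOver-*ˡ : ∀ c f ks → c * sumOver f ks ≡ sumOver (λ k → c * f k) ks
  sumOver-*ˡ c f []       = *-zeroʳ c
  sumOver-*ˡ c f (k ∷ ks) = trans (*-distribˡ-+ c (f k) _) (cong (_+_ (c * f k)) (sumOver-*ˡ c f ks))

  Σ-shift : ∀ lo hi f → Σ[ suc lo ≤k≤ suc hi ] f ≡ Σ[ lo ≤k≤ hi ] (f ∘ suc)
  Σ-shift lo hi f = begin
    sumOver f (drop lo (applyUpTo suc (suc hi)))    ≡⟨ cong (sumOver f ∘ drop lo) (map-upTo suc (suc hi)) ⟨
    sumOver f (drop lo (map suc (upTo (suc hi))))   ≡⟨ cong (sumOver f) (drop-map lo (upTo (suc hi))) ⟩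
    sumOver f (map suc (drop lo (upTo (suc hi))))   ≡⟨ foldr-map _ suc (+ 0) (drop lo (upTo (suc hi))) ⟩
    Σ[ lo ≤k≤ hi ] (f ∘ suc)                        ∎

  Σ-split : ∀ lo hi f → lo ≤ hi → Σ[ lo ≤k≤ hi ] f ≡ f lo + Σ[ suc lo ≤k≤ hi ] f
  Σ-split zero     hi       f z≤n         = refl
  Σ-split (suc lo) (suc hi) f (s≤s lo≤hi) = trans (Σ-shift lo hi f)
    (trans (Σ-split lo hi (f ∘ suc) lo≤hi) (cong (_+_ (f (suc lo))) (sym (Σ-shift (suc lo) hi f))))

  Σ-cong-from : ∀ lo hi {f g} → (∀ k → lo ≤ k → f k ≡ g k) → Σ[ lo ≤k≤ hi ] f ≡ Σ[ lo ≤k≤ hi ] g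
  Σ-cong-from zero           hi       f≗g = sumOver-cong (λ k → f≗g k z≤n) (upTo (suc hi))
  Σ-cong-from (suc zero)     zero     f≗g = refl
  Σ-cong-from (suc (suc lo)) zero     f≗g = refl
  Σ-cong-from (suc lo)       (suc hi) {f} {g} f≗g = trans (Σ-shift lo hi f)
    (trans (Σ-cong-from lo hi (λ k lo≤k → f≗g (suc k) (s≤s lo≤k))) (sym (Σ-shift lo hi g)))

  Σ-*ˡ : ∀ c lo hi f → c * Σ[ lo ≤k≤ hi ] f ≡ Σ[ lo ≤k≤ hi ] (λ k → c * f k)
  Σ-*ˡ c lo hi f = sumOver-*ˡ c f (drop lo (upTo (suc hi)))

module ClosedForm (a b : ℕ) (f : ℤ → ℕ) where
  open IntervalSums
  open import Data.Integer.Base using (_+_; _-_; _*_)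
  open import Data.Integer.Properties
    using (pos-*; [1+m]⊖[1+n]≡m⊖n; [+m]-[+n]≡m⊖n; *-zeroʳ; *-identityˡ; *-assoc)
  open import Data.Integer.Tactic.RingSolver using (solve-∀)
  open import Data.Nat.Base using (_^_; _∸_; _≤_; z≤n; s≤s)
  open import Data.Nat.Properties using (+-∸-assoc; <⇒≤) renaming (*-identityʳ to *-identityʳ-ℕ)
  open ≡-Reasoning

  S₁ S₂ : ℕ → ℤ
  S₁ n = Σ[ 3 ≤k≤ n ] (λ k → + (a ^ (k ∸ 2)) * + f (+ n - + k))
  S₂ n = Σ[ 3 ≤k≤ n ] (λ k → + (a ^ (k ∸ 3)) * + f (+ n - + k - + 1))

  sub-suc : ∀ m k → + suc m - + suc k ≡ + m - + k
  sub-suc m k = trans ([1+m]⊖[1+n]≡m⊖n m k) (sym ([+m]-[+n]≡m⊖n m k))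

  shifted-term : ∀ {j} k {x y} → j ≤ k → x ≡ y →
    + (a ^ (suc k ∸ j)) * + f x ≡ + a * (+ (a ^ (k ∸ j)) * + f y)
  shifted-term k j≤k x≡y = trans
    (cong₂ _*_ (trans (cong (λ e → + (a ^ e)) (+-∸-assoc 1 j≤k)) (pos-* a _)) (cong (λ i → + f i) x≡y))
    (*-assoc (+ a) _ _)

  S₁-suc : (∀ k → f -[1+ k ] ≡ 0) → ∀ m → S₁ (suc m) ≡ + a * + f (+ m - + 2) + + a * S₁ m
  S₁-suc neg zero          rewrite neg 1 = sym (cong₂ _+_ (*-zeroʳ (+ a)) (*-zeroʳ (+ a)))
  S₁-suc neg (suc zero)    rewrite neg 0 = sym (cong₂ _+_ (*-zeroʳ (+ a)) (*-zeroʳ (+ a)))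
  S₁-suc neg m@(suc (suc t)) = begin
    S₁ (suc m)
      ≡⟨ Σ-split 3 (suc m) F (s≤s (s≤s (s≤s z≤n))) ⟩
    F 3 + Σ[ 4 ≤k≤ suc m ] F
      ≡⟨ cong₂ _+_ (cong (λ e → + e * + f (+ t)) (*-identityʳ-ℕ a))
                   (trans (Σ-shift 3 m F)
                          (Σ-cong-from 3 m (λ k 3≤k → shifted-term k (<⇒≤ 3≤k) (sub-suc m k)))) ⟩
    + a * + f (+ t) + Σ[ 3 ≤k≤ m ] (λ k → + a * F′ k)
      ≡⟨ cong (_+_ (+ a * + f (+ t))) (Σ-*ˡ (+ a) 3 m F′) ⟨
    + a * + f (+ t) + + a * S₁ m ∎
    where
    F F′ : ℕ → ℤ
    F k = + (a ^ (k ∸ 2)) * + f (+ suc m - + k)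
    F′ k = + (a ^ (k ∸ 2)) * + f (+ m - + k)

  S₂-suc : (∀ k → f -[1+ k ] ≡ 0) → ∀ m → S₂ (suc m) ≡ + f (+ m - + 3) + + a * S₂ m
  S₂-suc neg zero          rewrite neg 2 = sym (cong (_+_ (+ 0)) (*-zeroʳ (+ a)))
  S₂-suc neg (suc zero)    rewrite neg 1 = sym (cong (_+_ (+ 0)) (*-zeroʳ (+ a)))
  S₂-suc neg m@(suc (suc t)) = begin
    S₂ (suc m)
      ≡⟨ Σ-split 3 (suc m) F (s≤s (s≤s (s≤s z≤n))) ⟩
    F 3 + Σ[ 4 ≤k≤ suc m ] F
      ≡⟨ cong₂ _+_ (trans (*-identityˡ _)
                          (cong (λ i → + f i) (sym (trans (sub-suc (suc t) 2) (sub-suc t 1)))))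
                   (trans (Σ-shift 3 m F)
                          (Σ-cong-from 3 m (λ k 3≤k → shifted-term k 3≤k (cong (_- + 1) (sub-suc m k))))) ⟩
    + f (+ m - + 3) + Σ[ 3 ≤k≤ m ] (λ k → + a * F′ k)
      ≡⟨ cong (_+_ (+ f (+ m - + 3))) (Σ-*ˡ (+ a) 3 m F′) ⟨
    + f (+ m - + 3) + + a * S₂ m ∎
    where
    F F′ : ℕ → ℤ
    F k = + (a ^ (k ∸ 3)) * + f (+ suc m - + k - + 1)
    F′ k = + (a ^ (k ∸ 3)) * + f (+ m - + k - + 1)

  recurrence-ℤ : Recurrence a b f → ∀ m →
    + f (+ suc m) ≡ + a * + f (+ m) + + b * + f (+ m - + 1)
                    + + a * + b * + f (+ m - + 2) + + b * + b * + f (+ m - + 3)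
  recurrence-ℤ rec m = trans (cong +_ (rec m))
    (cong₂ _+_ (cong₂ _+_ (cong₂ _+_ (pos-* a _) (pos-* b _)) (pos-*₂ a b _)) (pos-*₂ b b _))
    where
    pos-*₂ : ∀ x y z → + (x ℕ.* y ℕ.* z) ≡ + x * + y * + z
    pos-*₂ x y z = trans (pos-* (x ℕ.* y) z) (cong (_* + z) (pos-* x y))

  closed-form : f (+ 0) ≡ 1 → (∀ k → f -[1+ k ] ≡ 0) → Recurrence a b f → ∀ n →
    + f (+ n) ≡ + (a ^ n) + (+ b * + f (+ n - + 2) + + 2 * + b * S₁ n + + b * + b * S₂ n)
  closed-form f₀≡1 neg rec zero rewrite f₀≡1 | neg 1 = vanishing (+ b)
    where
    vanishing : ∀ B → + 1 ≡ + 1 + (B * + 0 + + 2 * B * + 0 + B * B * + 0)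
    vanishing = solve-∀
  closed-form f₀≡1 neg rec (suc m) = begin
    + f (+ suc m)
      ≡⟨ recurrence-ℤ rec m ⟩
    A * + f (+ m) + B * F₁ + A * B * F₂ + B * B * F₃
      ≡⟨ cong (λ x → A * x + B * F₁ + A * B * F₂ + B * B * F₃) (closed-form f₀≡1 neg rec m) ⟩
    A * (+ (a ^ m) + (B * F₂ + + 2 * B * S₁ m + B * B * S₂ m)) + B * F₁ + A * B * F₂ + B * B * F₃
      ≡⟨ regroup A B (+ (a ^ m)) F₁ F₂ F₃ (S₁ m) (S₂ m) ⟩
    A * + (a ^ m) + (B * F₁ + + 2 * B * (A * F₂ + A * S₁ m) + B * B * (F₃ + A * S₂ m))
      ≡⟨ cong₂ _+_ (pos-* a (a ^ m)) (cong₂ _+_ (cong₂ _+_ (cong (λ i → B * + f i) (sub-suc m 1))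
                                                          (cong (+ 2 * B *_) (S₁-suc neg m)))
                                               (cong (B * B *_) (S₂-suc neg m))) ⟨
    + (a ^ suc m) + (B * + f (+ suc m - + 2) + + 2 * B * S₁ (suc m) + B * B * S₂ (suc m)) ∎
    where
    A B F₁ F₂ F₃ : ℤ
    A = + a
    B = + b
    F₁ = + f (+ m - + 1)
    F₂ = + f (+ m - + 2)
    F₃ = + f (+ m - + 3)
    regroup : ∀ x y p u v w s t →
      x * (p + (y * v + + 2 * y * s + y * y * t)) + y * u + x * y * v + y * y * w
        ≡ x * p + (y * u + + 2 * y * (x * v + x * s) + y * y * (w + x * t))
    regroup = solve-∀

open import Data.Nat.Base using (_≤_; _^_; _∸_)
open import Data.Integer.Base using (_+_; _-_; _*_)
open import Data.Integer.Tactic.RingSolver using (solve-∀)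

-- The identity holds for all a, b and n.
theorem6 : (a b n : ℕ) → 1 ≤ a → 1 ≤ b → 1 ≤ n →
    (+ h a b (+ n)) - (+ (a ^ n))
      ≡ (+ b) * (+ h a b ((+ n) - (+ 2)))
        + (+ 2) * (+ b) * Σ[ 3 ≤k≤ n ] (λ k → (+ (a ^ (k ∸ 2))) * (+ h a b ((+ n) - (+ k))))
        + (+ b) * (+ b) * Σ[ 3 ≤k≤ n ] (λ k → (+ (a ^ (k ∸ 3))) * (+ h a b ((+ n) - (+ k) - (+ 1))))
theorem6 a b n _ _ _ =
  trans (cong (_- + (a ^ n)) (closed-form refl (λ _ → refl) h-recurrence n)) (cancel (+ (a ^ n)) _)
  where
  open ClosedForm a b (h a b)
  open Tilings a b using (h-recurrence)
  cancel : ∀ x y → x + y - x ≡ y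
  cancel = solve-∀
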